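{- Let $N>2$ and let $G$ be an $N$-player partizan game. Then $0\le_L G$ if and only if either $G\cong 0$ or every option of $G$ is a Left option (no player other than Left has an option in $G$).
   Context: An $N$-player partizan game ($N\ge2$) is an ordered $N$-tuple $(\mathscr G^{C_0},\dots,\mathscr G^{C_{N-1}})$ of finite sets of partizan games (with no infinite runs); the players are Left $=C_0$, $\mathrm{Center}_1=C_1,\dots,\mathrm{Center}_{N-2}=C_{N-2}$, Right $=C_{N-1}$, who move cyclically (Left after Right), and $\mathscr G^{C_i}$ is the set of options available to $C_i$ when it is their turn. Under normal play, a player with no option on their turn is the unique loser and all other players win. $0$ is the game with no options; $\cong$ is isomorphism of game trees. The disjunctive sum $G+H$ has $C_i$-options $G^{C_i}+H$ and $G+H^{C_i}$. "Left has a winning strategy in $G$ moving $i$th" ($1\le i\le N$) means: with the first move made by the player for whom Left is the $i$th player to move, Left can guarantee not being the loser. Write $G\le_L H$ if for every game $X$ and every $1\le i\le N$, whenever Left has a winning strategy in $G+X$ moving $i$th, Left has a winning strategy in $H+X$ moving $i$th. -}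

module Defs where

open import Data.Nat using (ℕ; zero; suc; _∸_)
open import Data.Nat.DivMod using (_%_; m%n<n)
open import Data.Fin using (Fin; zero; suc; toℕ; fromℕ<)
open import Data.List using (List; []; _∷_; _++_)
open import Data.List.Membership.Propositional using (_∈_)
open import Data.Product using (Σ; _×_; _,_)
open import Relation.Binary.PropositionalEquality using (_≡_; _≢_)

-- An N-player partizan game: for each player C_i (i : Fin N) a finite
-- collection (list) of options.  Player 0 is Left, player N-1 is Right.
data Game (N : ℕ) : Set where
  mk : (Fin N → List (Game N)) → Game N

options : ∀ {N} → Game N → Fin N → List (Game N)
options (mk f) = f

0G : ∀ {N} → Game N
0G = mk (λ _ → [])

mutual
  _+G_ : ∀ {N} → Game N → Game N → Game N
  mk f +G mk g = mk (λ i → addR (f i) (mk g) ++ addL (mk f) (g i))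

  addR : ∀ {N} → List (Game N) → Game N → List (Game N)
  addR [] h = []
  addR (x ∷ xs) h = (x +G h) ∷ addR xs h

  addL : ∀ {N} → Game N → List (Game N) → List (Game N)
  addL g [] = []
  addL g (y ∷ ys) = (g +G y) ∷ addL g ys

infixl 6 _+G_

Left : ∀ {n} → Fin (suc n)
Left = zero

next : ∀ {n} → Fin (suc n) → Fin (suc n)
next {n} i = fromℕ< (m%n<n (suc (toℕ i)) (suc n))

-- LeftSurvives G j : with player j to move in G, Left can guarantee not
-- being the (unique) loser, whatever the other players do.
data LeftSurvives {n : ℕ} : Game (suc n) → Fin (suc n) → Set where
  leftMove : ∀ {G g} → g ∈ options G Left → LeftSurvives g (next Left) →
             LeftSurvives G Left
  otherMove : ∀ {G j} → j ≢ Left →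
              (∀ {g} → g ∈ options G j → LeftSurvives g (next j)) →
              LeftSurvives G j

-- For k : Fin N encoding i = k + 1 (1 ≤ i ≤ N): the player who makes the
-- first move when Left is the i-th player to move, i.e. C_{(N - (i-1)) mod N}.
firstMover : ∀ {n} → Fin (suc n) → Fin (suc n)
firstMover {n} k = fromℕ< (m%n<n (suc n ∸ toℕ k) (suc n))

LeftWinsMoving : ∀ {n} → Game (suc n) → Fin (suc n) → Set
LeftWinsMoving G k = LeftSurvives G (firstMover k)

_≤L_ : ∀ {n} → Game (suc n) → Game (suc n) → Set
_≤L_ {n} G H = (X : Game (suc n)) (k : Fin (suc n)) →
  LeftWinsMoving (G +G X) k → LeftWinsMoving (H +G X) k

IsZero : ∀ {N} → Game N → Set
IsZero {N} G = (j : Fin N) → options G j ≡ []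

OnlyLeftOptions : ∀ {n} → Game (suc n) → Set
OnlyLeftOptions {n} G = (j : Fin (suc n)) → j ≢ Left → options G j ≡ []

module Submission where

-- (⇐) More generally H ≤_L G whenever H has no Left options and G has only
--     Left options: in G + X Left replays her strategy from H + X, since all
--     her moves there are moves in X and so are all her opponents' moves in
--     G + X.
-- (⇒) Suppose player j ≠ Left has an option x in G.  We build a test game
--     X in which neither Left nor j can move, while every other player can
--     enter a long chain (d consecutive moves available to every non-Left
--     player, none to Left).  With j to move, Left survives 0 + X since j is stuck,
--     but in G + X player j moves to x + X, the next opponent enters the
--     chain, and Left (who can only move in x, at most `leftHeight x` times)
--     runs out of moves before the chain does.  The case where j is Right
--     (so Left moves straight after j) uses N > 2: the player after Left is
--     then neither Left nor j.

open import Defs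
open import Data.Nat using (ℕ; zero; suc; _<_; _≤_; _+_; _*_; _∸_; _⊔_; z≤n; s≤s; s≤s⁻¹; _<?_)
open import Data.Nat.Properties
  using (≤-refl; ≤-trans; ≤-antisym; <-irrefl; <⇒≤; <⇒≱; ≮⇒≥; m≤m+n; m≤n+m; m≤m⊔n; m≤n⊔m; +-comm; +-suc; +-identityʳ; *-suc; *-monoʳ-≤; +-monoʳ-≤; +-cancelʳ-≤; ∸-monoʳ-<; m∸[m∸n]≡n; 0≢1+n; 1+n≢n; module ≤-Reasoning)
open import Data.Nat.DivMod using (_%_; m<n⇒m%n≡m; n%n≡0)
open import Data.Fin using (Fin; zero; suc; toℕ; fromℕ<)
open import Data.Fin.Properties using (_≟_; toℕ-injective; toℕ<n; toℕ-fromℕ<)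
open import Data.List using (List; []; _∷_)
open import Data.List.Membership.Propositional using (_∈_; _∉_)
open import Data.List.Membership.Propositional.Properties using (∈-++⁻; ∈-++⁺ˡ; ∈-++⁺ʳ)
open import Data.List.Relation.Unary.Any using (here; there)
open import Data.Product using (_×_; _,_; ∃-syntax)
open import Data.Sum using (_⊎_; inj₁; inj₂; [_,_])
open import Data.Empty using (⊥; ⊥-elim)
open import Relation.Nullary using (Dec; yes; no)
open import Relation.Binary.PropositionalEquality
  using (_≡_; _≢_; refl; sym; trans; cong; subst; subst₂; module ≡-Reasoning)
open import Function using (id; _⇔_; mk⇔)

module _ {n : ℕ} where

  N : ℕ
  N = suc n

  Player : Set
  Player = Fin N

  GameN : Set
  GameN = Game N

  ∉-empty : ∀ {x : GameN} {xs} → xs ≡ [] → x ∉ xs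
  ∉-empty refl ()

  addR⁻ : ∀ {g} (xs : List GameN) (Y : GameN) → g ∈ addR xs Y →
          ∃[ a ] a ∈ xs × g ≡ a +G Y
  addR⁻ (x ∷ xs) Y (here eq) = x , here refl , eq
  addR⁻ (x ∷ xs) Y (there m) with addR⁻ xs Y m
  ... | a , a∈xs , eq = a , there a∈xs , eq

  addL⁻ : ∀ {g} (A : GameN) (ys : List GameN) → g ∈ addL A ys →
          ∃[ y ] y ∈ ys × g ≡ A +G y
  addL⁻ A (y ∷ ys) (here eq) = y , here refl , eq
  addL⁻ A (y ∷ ys) (there m) with addL⁻ A ys m
  ... | b , b∈ys , eq = b , there b∈ys , eq

  addR⁺ : ∀ {a} (xs : List GameN) (Y : GameN) → a ∈ xs → (a +G Y) ∈ addR xs Y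
  addR⁺ (x ∷ xs) Y (here refl) = here refl
  addR⁺ (x ∷ xs) Y (there m) = there (addR⁺ xs Y m)

  addL⁺ : ∀ {y} (A : GameN) (ys : List GameN) → y ∈ ys → (A +G y) ∈ addL A ys
  addL⁺ A (y ∷ ys) (here refl) = here refl
  addL⁺ A (y ∷ ys) (there m) = there (addL⁺ A ys m)

  sum-option⁻ : ∀ (A Y : GameN) i {g} → g ∈ options (A +G Y) i →
    (∃[ a ] a ∈ options A i × g ≡ a +G Y) ⊎ (∃[ y ] y ∈ options Y i × g ≡ A +G y)
  sum-option⁻ (mk f) (mk h) i m with ∈-++⁻ (addR (f i) (mk h)) m
  ... | inj₁ m′ = inj₁ (addR⁻ (f i) (mk h) m′)
  ... | inj₂ m′ = inj₂ (addL⁻ (mk f) (h i) m′)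

  sum-optionˡ : ∀ (A Y : GameN) i {a} → a ∈ options A i → (a +G Y) ∈ options (A +G Y) i
  sum-optionˡ (mk f) (mk h) i m = ∈-++⁺ˡ (addR⁺ (f i) (mk h) m)

  sum-optionʳ : ∀ (A Y : GameN) i {y} → y ∈ options Y i → (A +G y) ∈ options (A +G Y) i
  sum-optionʳ (mk f) (mk h) i m = ∈-++⁺ʳ (addR (f i) (mk h)) (addL⁺ (mk f) (h i) m)

  sum-stuck : ∀ (A Y : GameN) i → options A i ≡ [] → options Y i ≡ [] →
              ∀ {g} → g ∉ options (A +G Y) i
  sum-stuck A Y i A-stuck Y-stuck m with sum-option⁻ A Y i m
  ... | inj₁ (_ , a∈ , _) = ∉-empty A-stuck a∈
  ... | inj₂ (_ , y∈ , _) = ∉-empty Y-stuck y∈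

  NoLeftOptions : GameN → Set
  NoLeftOptions H = options H Left ≡ []

  -- Left's strategy in H + Y is also one in G + Y: her moves are all in Y
  -- (H has no Left options), and so are her opponents' (G has only Left
  -- options).  The summand H stays fixed along the play.
  replay : ∀ {H G : GameN} → NoLeftOptions H → OnlyLeftOptions G →
           ∀ {T p} → LeftSurvives T p → ∀ Y → T ≡ H +G Y → LeftSurvives (G +G Y) p
  replay {H} {G} noL onlyL (leftMove m survives) Y refl with sum-option⁻ H Y Left m
  ... | inj₁ (_ , h∈ , _) = ⊥-elim (∉-empty noL h∈)
  ... | inj₂ (y , y∈ , refl) =
    leftMove (sum-optionʳ G Y Left y∈) (replay noL onlyL survives y refl)
  replay {H} {G} noL onlyL (otherMove {j = j} j≢L survives) Y refl = otherMove j≢L answer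
    where
      answer : ∀ {g} → g ∈ options (G +G Y) j → LeftSurvives g (next j)
      answer m with sum-option⁻ G Y j m
      ... | inj₁ (_ , a∈ , _) = ⊥-elim (∉-empty (onlyL j j≢L) a∈)
      ... | inj₂ (y , y∈ , refl) = replay noL onlyL (survives (sum-optionʳ H Y j y∈)) y refl

  ≤L-noLeft-onlyLeft : ∀ {H G : GameN} → NoLeftOptions H → OnlyLeftOptions G → H ≤L G
  ≤L-noLeft-onlyLeft noL onlyL X k survives = replay noL onlyL survives X refl

  next-cases : ∀ (p : Player) → toℕ (next p) ≡ suc (toℕ p) ⊎ (toℕ p ≡ n × next p ≡ Left)
  next-cases p with suc (toℕ p) <? N
  ... | yes p+1<N = inj₁ (trans (toℕ-fromℕ< _) (m<n⇒m%n≡m p+1<N))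
  ... | no p+1≮N = inj₂ (p≡n , toℕ-injective (begin
          toℕ (next p)      ≡⟨ toℕ-fromℕ< _ ⟩
          suc (toℕ p) % N   ≡⟨ cong (λ m → suc m % N) p≡n ⟩
          N % N             ≡⟨ n%n≡0 N ⟩
          0                 ∎))
    where
      open ≡-Reasoning
      p≡n : toℕ p ≡ n
      p≡n = ≤-antisym (s≤s⁻¹ (toℕ<n p)) (s≤s⁻¹ (≮⇒≥ p+1≮N))

  next-Left : 1 < N → toℕ (next (Left {n})) ≡ 1
  next-Left 1<N = trans (toℕ-fromℕ< _) (m<n⇒m%n≡m 1<N)

  firstMover-surjective : ∀ (j : Player) → ∃[ k ] firstMover k ≡ j
  firstMover-surjective zero = zero , toℕ-injective (trans (toℕ-fromℕ< _) (n%n≡0 N))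
  firstMover-surjective j@(suc _) = fromℕ< N∸j<N , toℕ-injective (begin
      toℕ (firstMover (fromℕ< N∸j<N))   ≡⟨ toℕ-fromℕ< _ ⟩
      (N ∸ toℕ (fromℕ< N∸j<N)) % N      ≡⟨ cong (λ m → (N ∸ m) % N) (toℕ-fromℕ< N∸j<N) ⟩
      (N ∸ (N ∸ toℕ j)) % N             ≡⟨ cong (_% N) (m∸[m∸n]≡n (<⇒≤ (toℕ<n j))) ⟩
      toℕ j % N                         ≡⟨ m<n⇒m%n≡m (toℕ<n j) ⟩
      toℕ j                             ∎)
    where
      open ≡-Reasoning
      N∸j<N : N ∸ toℕ j < N
      N∸j<N = ∸-monoʳ-< {N} {toℕ j} {0} (s≤s z≤n) (<⇒≤ (toℕ<n j))

  mutual
    leftHeight : GameN → ℕ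
    leftHeight (mk f) = leftHeightMax (f Left)

    leftHeightMax : List GameN → ℕ
    leftHeightMax [] = 0
    leftHeightMax (g ∷ gs) = suc (leftHeight g) ⊔ leftHeightMax gs

  leftHeightMax-∈ : ∀ {a} (xs : List GameN) → a ∈ xs → suc (leftHeight a) ≤ leftHeightMax xs
  leftHeightMax-∈ (x ∷ xs) (here refl) = m≤m⊔n (suc (leftHeight x)) (leftHeightMax xs)
  leftHeightMax-∈ (x ∷ xs) (there m) =
    ≤-trans (leftHeightMax-∈ xs m) (m≤n⊔m (suc (leftHeight x)) (leftHeightMax xs))

  -- A Left move lowers Left's height; measured in rounds of N turns, it
  -- frees up a full round.
  leftOption-rounds : ∀ (A : GameN) {a} → a ∈ options A Left →
                      N * leftHeight a + N ≤ N * leftHeight A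
  leftOption-rounds (mk f) {a} a∈ = begin
    N * leftHeight a + N   ≡⟨ +-comm (N * leftHeight a) N ⟩
    N + N * leftHeight a   ≡⟨ *-suc N (leftHeight a) ⟨
    N * suc (leftHeight a) ≤⟨ *-monoʳ-≤ N (leftHeightMax-∈ (f Left) a∈) ⟩
    N * leftHeight (mk f)  ∎
    where open ≤-Reasoning

  mutual
    chain : ℕ → GameN
    chain zero = 0G
    chain (suc d) = mk (chainOptions d)

    chainOptions : ℕ → Player → List GameN
    chainOptions d zero = []
    chainOptions d (suc _) = chain d ∷ []

  chain-noLeft : ∀ d → NoLeftOptions (chain d)
  chain-noLeft zero = refl
  chain-noLeft (suc d) = refl

  -- Turns owed to the opponents before Left's next turn, rounded up to a
  -- full round when an opponent is to move.
  roundCost : ℕ → ℕ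
  roundCost zero = 0
  roundCost (suc _) = N

  -- In A + chain d with p to move, the chain outlasts Left: her at most
  -- `leftHeight A` turns, each costing a round of opponent moves, plus the
  -- rest of the current round, fit into the d chain moves.
  Hopeless : GameN → ℕ → Player → Set
  Hopeless A d p = N * leftHeight A + roundCost (toℕ p) ≤ d + toℕ p

  hopeless-anyone : ∀ A d p → N * leftHeight A + N ≤ d → Hopeless A d p
  hopeless-anyone A d p budget = begin
    N * leftHeight A + roundCost (toℕ p) ≤⟨ +-monoʳ-≤ (N * leftHeight A) (roundCost≤N (toℕ p)) ⟩
    N * leftHeight A + N                 ≤⟨ budget ⟩
    d                                    ≤⟨ m≤m+n d (toℕ p) ⟩
    d + toℕ p                            ∎
    where
      open ≤-Reasoning
      roundCost≤N : ∀ m → roundCost m ≤ N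
      roundCost≤N zero = z≤n
      roundCost≤N (suc _) = ≤-refl

  -- After an opponent's chain move the position stays hopeless: one chain
  -- move pays for one turn; after Right the round cost N is settled exactly.
  hopeless-afterOpponent : ∀ A d (j : Fin n) → Hopeless A (suc d) (suc j) →
                           Hopeless A d (next (suc j))
  hopeless-afterOpponent A d j hopeless with next-cases (suc j)
  ... | inj₁ eq rewrite eq = subst (N * leftHeight A + N ≤_) (sym (+-suc d (suc (toℕ j)))) hopeless
  ... | inj₂ (j+1≡n , eq) rewrite eq = subst₂ _≤_ (sym (+-identityʳ _)) (sym (+-identityʳ _))
          (+-cancelʳ-≤ n _ _ (s≤s⁻¹ (subst₂ _≤_ (+-suc (N * leftHeight A) n)
                                                (cong (λ m → suc (d + m)) j+1≡n) hopeless)))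

  chain-wins : ∀ {T p} → LeftSurvives T p → ∀ A d → T ≡ A +G chain d → Hopeless A d p → ⊥
  chain-wins (leftMove m survives) A d refl hopeless with sum-option⁻ A (chain d) Left m
  ... | inj₂ (_ , y∈ , _) = ∉-empty (chain-noLeft d) y∈
  ... | inj₁ (a , a∈ , refl) = chain-wins survives a d refl (hopeless-anyone a d (next Left) budget)
    where
      budget : N * leftHeight a + N ≤ d
      budget = ≤-trans (leftOption-rounds A a∈)
                       (subst₂ _≤_ (+-identityʳ _) (+-identityʳ _) hopeless)
  chain-wins (otherMove {j = zero} j≢L _) A d refl hopeless = j≢L refl
  chain-wins (otherMove {j = suc j} _ _) A zero refl hopeless =
    <⇒≱ (toℕ<n (suc j)) (≤-trans (m≤n+m N (N * leftHeight A)) hopeless)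
  chain-wins (otherMove {j = suc j} _ survives) A (suc d) refl hopeless =
    chain-wins (survives (sum-optionʳ A (chain (suc d)) (suc j) (here refl))) A d refl
               (hopeless-afterOpponent A d j hopeless)

  unless : ∀ {P : Set} → Dec P → List GameN → List GameN
  unless (yes _) _ = []
  unless (no _) xs = xs

  testGame : Player → ℕ → GameN
  testGame j D = mk (λ p → unless (p ≟ j) (chainOptions D p))

  testGame-stuck : ∀ j D → options (testGame j D) j ≡ []
  testGame-stuck j D with j ≟ j
  ... | yes _ = refl
  ... | no j≢j = ⊥-elim (j≢j refl)

  testGame-noLeft : ∀ j D → NoLeftOptions (testGame j D)
  testGame-noLeft j D with Left ≟ j
  ... | yes _ = refl
  ... | no _ = refl

  testGame-enter : ∀ j D r → r ≢ Left → r ≢ j → chain D ∈ options (testGame j D) r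
  testGame-enter j D r r≢L r≢j with r ≟ j
  ... | yes r≡j = ⊥-elim (r≢j r≡j)
  testGame-enter j D zero r≢L r≢j | no _ = ⊥-elim (r≢L refl)
  testGame-enter j D (suc _) r≢L r≢j | no _ = here refl

  enter-chain : ∀ j D A {T r} → LeftSurvives T r → T ≡ A +G testGame j D →
                r ≢ Left → r ≢ j → N * leftHeight A + N ≤ D → ⊥
  enter-chain j D A (leftMove _ _) refl L≢L _ _ = L≢L refl
  enter-chain j D A (otherMove {j = r} _ survives) refl r≢L r≢j budget =
    chain-wins (survives (sum-optionʳ A (testGame j D) r (testGame-enter j D r r≢L r≢j)))
               A D refl (hopeless-anyone A D (next r) budget)

  -- If j is Right, Left moves right after j and only in A; the next player,
  -- 1, is neither Left nor j since N > 2, and enters the chain.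
  left-after-right : 2 < N → ∀ j D A → toℕ j ≡ n → ∀ {T} → LeftSurvives T Left →
                     T ≡ A +G testGame j D → N * leftHeight A ≤ D → ⊥
  left-after-right _ j D A _ (otherMove L≢L _) _ _ = L≢L refl
  left-after-right 2<N j D A j≡n (leftMove m survives) refl budget
    with sum-option⁻ A (testGame j D) Left m
  ... | inj₂ (_ , y∈ , _) = ∉-empty (testGame-noLeft j D) y∈
  ... | inj₁ (a , a∈ , refl) =
    enter-chain j D a survives refl 1≢L 1≢j (≤-trans (leftOption-rounds A a∈) budget)
    where
      next≡1 : toℕ (next (Left {n})) ≡ 1
      next≡1 = next-Left (<⇒≤ 2<N)
      1≢L : next Left ≢ Left
      1≢L e = 0≢1+n (trans (sym (cong toℕ e)) next≡1)
      1≢j : next Left ≢ j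
      1≢j e = <-irrefl refl (subst (λ m → 2 < suc m) n≡1 2<N)
        where
          n≡1 : n ≡ 1
          n≡1 = trans (sym j≡n) (trans (sym (cong toℕ e)) next≡1)

  -- With j to move in G + testGame j D, player j must move in G, say to x;
  -- whoever moves next leads into the chain, which is long enough for x.
  j-loses-test : 2 < N → ∀ G j {x} → j ≢ Left → x ∈ options G j →
                 ∀ D → N * leftHeight x + N ≤ D → LeftSurvives (G +G testGame j D) j → ⊥
  j-loses-test _ G j j≢L _ D _ (leftMove _ _) = j≢L refl
  j-loses-test 2<N G j {x} j≢L x∈ D budget (otherMove _ survives)
    with survives (sum-optionˡ G (testGame j D) j x∈) | next-cases j
  ... | afterJ | inj₁ next≡j+1 = enter-chain j D x afterJ refl next≢L next≢j budget
    where
      next≢L : next j ≢ Left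
      next≢L e = 0≢1+n (trans (sym (cong toℕ e)) next≡j+1)
      next≢j : next j ≢ j
      next≢j e = 1+n≢n (trans (sym next≡j+1) (cong toℕ e))
  ... | afterJ | inj₂ (j≡n , next≡L) =
    left-after-right 2<N j D x j≡n (subst (LeftSurvives _) next≡L afterJ) refl
                     (≤-trans (m≤m+n (N * leftHeight x) N) budget)

  -- The forward direction: a non-Left option x of G for player j is
  -- detected by testGame j D, which Left survives with 0 but not with G.
  onlyLeft-of-0≤L : 2 < N → ∀ G → 0G ≤L G → OnlyLeftOptions G
  onlyLeft-of-0≤L 2<N G 0≤G j j≢L with options G j in eq
  ... | [] = refl
  ... | x ∷ _ = ⊥-elim (j-loses-test 2<N G j j≢L x∈ D ≤-refl survivesG)
    where
      x∈ : x ∈ options G j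
      x∈ = subst (x ∈_) (sym eq) (here refl)
      D : ℕ
      D = N * leftHeight x + N
      -- j is stuck in 0 + testGame j D, so Left survives it with j first.
      survives0 : LeftSurvives (0G +G testGame j D) j
      survives0 = otherMove j≢L (λ m → ⊥-elim (sum-stuck 0G (testGame j D) j refl (testGame-stuck j D) m))
      -- 0 ≤_L G transfers this, at the turn position k where j moves first.
      survivesG : LeftSurvives (G +G testGame j D) j
      survivesG with firstMover-surjective j
      ... | k , k↦j = subst (LeftSurvives _) k↦j
                        (0≤G (testGame j D) k (subst (LeftSurvives _) (sym k↦j) survives0))

mainTheorem12 : ∀ {n : ℕ} → 2 < suc n → (G : Game (suc n)) →
    (0G ≤L G) ⇔ (IsZero G ⊎ OnlyLeftOptions G)
mainTheorem12 2<N G = mk⇔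
  (λ 0≤G → inj₂ (onlyLeft-of-0≤L 2<N G 0≤G))
  (λ zeroOrOnlyLeft → ≤L-noLeft-onlyLeft refl ([ (λ G≅0 j _ → G≅0 j) , id ] zeroOrOnlyLeft))
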